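{- Let $\mathcal C\in\{\mathrm{ID},\mathrm{CD}\}$. The rule $(wv)$ (weakening with a domain atom) is height-preserving admissible in $\mathsf{LBIQ}(\mathcal C)$: if $\mathcal R,\mathcal T,\Gamma\vdash\Delta$ has a proof of height $n$ in $\mathsf{LBIQ}(\mathcal C)$, $x$ is a variable, and $w$ is a label such that $\mathcal R,\mathcal T,w:x,\Gamma\vdash\Delta$ is a sequent, then $\mathcal R,\mathcal T,w:x,\Gamma\vdash\Delta$ has a proof of height at most $n$ in $\mathsf{LBIQ}(\mathcal C)$.
   Context: Syntax. Terms from variables and function symbols (constants have arity $0$); $\mathrm{Ter}(X)$ = terms with variables in $X$ (contains all constants), $\mathrm{Ter}=\mathrm{Ter}(\mathrm{Var})$, $\mathrm{VT}(t)$ variables of $t$, $\mathrm{VT}(\vec t)=\bigcup_i\mathrm{VT}(t_i)$. Formulae: $\varphi::=p(\vec t)\mid\bot\mid\top\mid\varphi\wedge\varphi\mid\varphi\vee\varphi\mid\varphi\mathbin{ -\!\!<}\varphi\mid\varphi\to\varphi\mid\exists x\varphi\mid\forall x\varphi$ ($\mathbin{ -\!\!<}$ exclusion); $\varphi(t/x)$ capture-avoiding substitution. Sequents. Labeled formula $w:\varphi$, relational atom $wRu$, domain atom $w:x$. A sequent is $\mathcal R,\mathcal T,\Gamma\vdash\Delta$ ($\mathcal R$ finite multiset of relational atoms, $\mathcal T$ of domain atoms, $\Gamma,\Delta$ of labeled formulae) with (1) if $\mathcal R\ne\emptyset$ every label in $\mathcal T,\Gamma,\Delta$ occurs in $\mathcal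 R$, and if $\mathcal R=\emptyset$ exactly one label occurs; (2) the directed graph of $\mathcal R$ connected without directed or undirected cycles. $w\twoheadrightarrow^*_{\mathcal R}u$ iff $w=u$ or there is a chain $wRv_1,\dots,v_nRu$ in $\mathcal R$. $X_w=\{x\mid u:x\in\mathcal T,\ u\twoheadrightarrow^*_{\mathcal R}w\}$; $t$ available for $w$ iff $t\in\mathrm{Ter}(X_w)$. Fresh = not occurring in the conclusion; side conditions evaluated in the conclusion. $\mathsf{LBIQ}(\mathrm{ID})$ (premises$\,/\,$conclusion, unchanged parts omitted): (ax) $\Gamma,w:p(\vec t)\vdash\Delta,u:p(\vec t)$ if $w\twoheadrightarrow^*_{\mathcal R}u$; $(\bot L)$ $\Gamma,w:\bot\vdash\Delta$; $(\top R)$ $\Gamma\vdash\Delta,w:\top$; $(\wedge L)$ $\Gamma,w:\varphi,w:\psi\vdash\Delta\,/\,\Gamma,w:\varphi\wedge\psi\vdash\Delta$; $(\wedge R)$ $\Gamma\vdash\Delta,w:\varphi$ and $\Gamma\vdash\Delta,w:\psi\,/\,\Gamma\vdash\Delta,w:\varphi\wedge\psi$; $(\vee L)$ $\Gamma,w:\varphi\vdash\Delta$ and $\Gamma,w:\psi\vdash\Delta\,/\,\Gamma,w:\varphi\vee\psi\vdash\Delta$; $(\vee R)$ $\Gamma\vdash\Delta,w:\varphi,w:\psi\,/\,\Gamma\vdash\Delta,w:\varphi\vee\psi$; $(\to L)$ $\Gamma,w:\varphi\to\psi\vdash\Delta,u:\varphi$ and $\Gamma,w:\varphi\to\psi,u:\psi\vdash\Delta\,/\,\Gamma,w:\varphi\to\psi\vdash\Delta$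 if $w\twoheadrightarrow^*_{\mathcal R}u$; $(\to R)$ $\mathcal R,wRu,\mathcal T,\Gamma,u:\varphi\vdash\Delta,u:\psi\,/\,\mathcal R,\mathcal T,\Gamma\vdash\Delta,w:\varphi\to\psi$, $u$ fresh; $(\mathbin{ -\!\!<}L)$ $\mathcal R,uRw,\mathcal T,\Gamma,u:\varphi\vdash\Delta,u:\psi\,/\,\mathcal R,\mathcal T,\Gamma,w:\varphi\mathbin{ -\!\!<}\psi\vdash\Delta$, $u$ fresh; $(\mathbin{ -\!\!<}R)$ $\Gamma\vdash\Delta,u:\varphi\mathbin{ -\!\!<}\psi,w:\varphi$ and $\Gamma,w:\psi\vdash\Delta,u:\varphi\mathbin{ -\!\!<}\psi\,/\,\Gamma\vdash\Delta,u:\varphi\mathbin{ -\!\!<}\psi$ if $w\twoheadrightarrow^*_{\mathcal R}u$; $(\exists L)$ $\mathcal R,\mathcal T,w:y,\Gamma,w:\varphi(y/x)\vdash\Delta\,/\,\mathcal R,\mathcal T,\Gamma,w:\exists x\varphi\vdash\Delta$, $y$ fresh; $(\exists R)$ $\Gamma\vdash\Delta,w:\exists x\varphi,w:\varphi(t/x)\,/\,\Gamma\vdash\Delta,w:\exists x\varphi$ if $t$ available for $w$; $(\forall L)$ $\Gamma,w:\forall x\varphi,u:\varphi(t/x)\vdash\Delta\,/\,\Gamma,w:\forall x\varphi\vdash\Delta$ if $w\twoheadrightarrow^*_{\mathcal R}u$ and $t$ available for $u$; $(\forall R)$ $\mathcal R,wRu,\mathcal T,u:y,\Gamma\vdash\Delta,u:\varphi(y/x)\,/\,\mathcal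 R,\mathcal T,\Gamma\vdash\Delta,w:\forall x\varphi$, $u,y$ fresh; $(ds)$ $\mathcal R,\mathcal T,w:\mathrm{VT}(\vec t),\Gamma,w:p(\vec t)\vdash\Delta\,/\,\mathcal R,\mathcal T,\Gamma,w:p(\vec t)\vdash\Delta$. $\mathsf{LBIQ}(\mathrm{CD})$: remove $(ds)$, allow any $t\in\mathrm{Ter}$ in $(\exists R)$ and $(\forall L)$ (keeping $w\twoheadrightarrow^*_{\mathcal R}u$ in $(\forall L)$). Proofs are finite trees of rule instances with leaves (ax), $(\bot L)$, $(\top R)$; height = length of the longest branch. Sequents differing by a bijective label renaming are regarded as mutually derivable. -}

module Defs where

open import Data.Nat using (ℕ; zero; suc; _⊔_)
open import Data.Nat.Properties using (_≟_)
open import Data.Bool using (Bool; true; false; if_then_else_; _∨_)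
open import Data.List using (List; []; _∷_; _++_; map; concatMap; filter; deduplicate; length; lookup; foldr)
open import Data.List.Membership.Propositional using (_∈_; _∉_)
open import Data.List.Relation.Unary.All using (All)
open import Data.List.Relation.Unary.Unique.Propositional using (Unique)
open import Data.List.Relation.Binary.Permutation.Propositional using (_↭_)
open import Data.Product using (Σ; ∃; _×_; _,_; proj₁; proj₂)
open import Data.Sum using (_⊎_)
open import Data.Unit using (⊤)
open import Data.Fin using (Fin)
open import Relation.Nullary using (¬_; ¬?; does)
open import Relation.Binary.PropositionalEquality using (_≡_; _≢_)

Var : Set
Var = ℕ

Label : Set
Label = ℕ

FunSym : Set
FunSym = ℕ

PredSym : Set
PredSym = ℕ

data Term : Set where
  var : Var → Term
  fun : FunSym → List Term → Term

mutual
  vt : Term → List Var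
  vt (var x) = x ∷ []
  vt (fun f ts) = vts ts

  vts : List Term → List Var
  vts [] = []
  vts (t ∷ ts) = vt t ++ vts ts

mutual
  tsub : (Var → Term) → Term → Term
  tsub σ (var x) = σ x
  tsub σ (fun f ts) = fun f (tsubs σ ts)

  tsubs : (Var → Term) → List Term → List Term
  tsubs σ [] = []
  tsubs σ (t ∷ ts) = tsub σ t ∷ tsubs σ ts

infixr 6 _∧'_
infixr 5 _∨'_
infixr 4 _-<_ _⇒_

data Formula : Set where
  atom : PredSym → List Term → Formula
  ⊥' : Formula
  ⊤' : Formula
  _∧'_ : Formula → Formula → Formula
  _∨'_ : Formula → Formula → Formula
  _-<_ : Formula → Formula → Formula
  _⇒_ : Formula → Formula → Formula
  ex : Var → Formula → Formula
  all : Var → Formula → Formula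

fv : Formula → List Var
fv (atom p ts) = vts ts
fv ⊥' = []
fv ⊤' = []
fv (φ ∧' ψ) = fv φ ++ fv ψ
fv (φ ∨' ψ) = fv φ ++ fv ψ
fv (φ -< ψ) = fv φ ++ fv ψ
fv (φ ⇒ ψ) = fv φ ++ fv ψ
fv (ex y φ) = filter (λ v → ¬? (v ≟ y)) (fv φ)
fv (all y φ) = filter (λ v → ¬? (v ≟ y)) (fv φ)

memb : Var → List Var → Bool
memb y [] = false
memb y (v ∷ vs) = does (y ≟ v) ∨ memb y vs

maxList : List ℕ → ℕ
maxList = foldr _⊔_ 0

_[_↦_] : (Var → Term) → Var → Term → (Var → Term)
(σ [ y ↦ s ]) v = if does (v ≟ y) then s else σ v

-- bound variable to use when pushing σ under a binder y with body φ:
-- keep y unless it would capture a variable of some σ v (v free in the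
-- quantified formula); otherwise pick a variable not occurring in those σ v.
binderVar : (Var → Term) → Var → List Var → Var
binderVar σ y fvs =
  if memb y (concatMap (λ v → vt (σ v)) fvs)
  then suc (maxList (concatMap (λ v → vt (σ v)) fvs))
  else y

subst : (Var → Term) → Formula → Formula
subst σ (atom p ts) = atom p (tsubs σ ts)
subst σ ⊥' = ⊥'
subst σ ⊤' = ⊤'
subst σ (φ ∧' ψ) = subst σ φ ∧' subst σ ψ
subst σ (φ ∨' ψ) = subst σ φ ∨' subst σ ψ
subst σ (φ -< ψ) = subst σ φ -< subst σ ψ
subst σ (φ ⇒ ψ) = subst σ φ ⇒ subst σ ψ
subst σ (ex y φ) =
  let z = binderVar σ y (fv (ex y φ)) in ex z (subst (σ [ y ↦ var z ]) φ)
subst σ (all y φ) =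
  let z = binderVar σ y (fv (all y φ)) in all z (subst (σ [ y ↦ var z ]) φ)

_[_/_] : Formula → Term → Var → Formula
φ [ t / x ] = subst (var [ x ↦ t ]) φ

-- Sequents (multisets represented by lists; see `perm` below)

LFormula : Set
LFormula = Label × Formula

RelAtom : Set
RelAtom = Label × Label           -- (w , u) is  wRu

DomAtom : Set
DomAtom = Label × Var             -- (w , x) is  w : x

record Seq : Set where
  constructor ⟨_∣_∣_⊢_⟩
  field
    Rs : List RelAtom
    Ts : List DomAtom
    Γs : List LFormula
    Δs : List LFormula

labsR : List RelAtom → List Label
labsR = concatMap (λ e → proj₁ e ∷ proj₂ e ∷ [])

labsTΓΔ : Seq → List Label
labsTΓΔ ⟨ R ∣ T ∣ Γ ⊢ Δ ⟩ = map proj₁ T ++ map proj₁ Γ ++ map proj₁ Δ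

labels : Seq → List Label
labels s = labsR (Seq.Rs s) ++ labsTΓΔ s

vars : Seq → List Var
vars ⟨ R ∣ T ∣ Γ ⊢ Δ ⟩ = map proj₂ T ++ concatMap (λ a → fv (proj₂ a)) (Γ ++ Δ)

-- undirected walks in the multigraph R, recording the edge occurrences
-- (positions in R) used and the vertices left at each step
data UWalk (R : List RelAtom) : Label → Label → List (Fin (length R)) → List Label → Set where
  nil  : ∀ {a} → UWalk R a a [] []
  cons : ∀ {a b c is vs} (i : Fin (length R)) →
         (lookup R i ≡ (a , c) ⊎ lookup R i ≡ (c , a)) →
         UWalk R c b is vs → UWalk R a b (i ∷ is) (a ∷ vs)

UConnected : List RelAtom → Set
UConnected R = ∀ a b → a ∈ labsR R → b ∈ labsR R →
  Σ (List (Fin (length R))) λ is → Σ (List Label) λ vs → UWalk R a b is vs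

UCycle : List RelAtom → Set
UCycle R = Σ Label λ a → Σ (List (Fin (length R))) λ is → Σ (List Label) λ vs →
  UWalk R a a is vs × is ≢ [] × Unique is × Unique vs

data _⊢_↠_ (R : List RelAtom) : Label → Label → Set where
  here : ∀ {w} → R ⊢ w ↠ w
  step : ∀ {w v u} → (w , v) ∈ R → R ⊢ v ↠ u → R ⊢ w ↠ u

DCycle : List RelAtom → Set
DCycle R = Σ Label λ w → Σ Label λ v → (w , v) ∈ R × R ⊢ v ↠ w

IsSequent : Seq → Set
IsSequent s@(⟨ R ∣ T ∣ Γ ⊢ Δ ⟩) =
  (R ≢ [] → All (λ l → l ∈ labsR R) (labsTΓΔ s)) ×
  (R ≡ [] → Σ Label λ w → w ∈ labsTΓΔ s × All (λ l → l ≡ w) (labsTΓΔ s)) ×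
  UConnected R × ¬ DCycle R × ¬ UCycle R

_≈S_ : Seq → Seq → Set
⟨ R ∣ T ∣ Γ ⊢ Δ ⟩ ≈S ⟨ R' ∣ T' ∣ Γ' ⊢ Δ' ⟩ = R ↭ R' × T ↭ T' × Γ ↭ Γ' × Δ ↭ Δ'

data Cond : Set where
  ID CD : Cond

InX : List RelAtom → List DomAtom → Label → Var → Set
InX R T w x = Σ Label λ u → (u , x) ∈ T × R ⊢ u ↠ w

-- admissible instantiating terms for (∃R)/(∀L)
Avail : Cond → List RelAtom → List DomAtom → Label → Term → Set
Avail ID R T w t = All (InX R T w) (vt t)
Avail CD R T w t = ⊤

FreshL : Label → Seq → Set
FreshL u s = u ∉ labels s

FreshV : Var → Seq → Set
FreshV y s = y ∉ vars s

-- Proof trees. Every rule instance demands that its conclusion is a sequent.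
-- `perm` only re-orders the lists (multisets) and is not a rule instance.
data Proof (C : Cond) : Seq → Set where
  perm : ∀ {s s'} → s ≈S s' → Proof C s → Proof C s'
  ax : ∀ {R T Γ Δ w u p ts} →
       IsSequent ⟨ R ∣ T ∣ (w , atom p ts) ∷ Γ ⊢ (u , atom p ts) ∷ Δ ⟩ →
       R ⊢ w ↠ u →
       Proof C ⟨ R ∣ T ∣ (w , atom p ts) ∷ Γ ⊢ (u , atom p ts) ∷ Δ ⟩
  ⊥L : ∀ {R T Γ Δ w} →
       IsSequent ⟨ R ∣ T ∣ (w , ⊥') ∷ Γ ⊢ Δ ⟩ →
       Proof C ⟨ R ∣ T ∣ (w , ⊥') ∷ Γ ⊢ Δ ⟩
  ⊤R : ∀ {R T Γ Δ w} →
       IsSequent ⟨ R ∣ T ∣ Γ ⊢ (w , ⊤') ∷ Δ ⟩ →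
       Proof C ⟨ R ∣ T ∣ Γ ⊢ (w , ⊤') ∷ Δ ⟩
  ∧L : ∀ {R T Γ Δ w φ ψ} →
       IsSequent ⟨ R ∣ T ∣ (w , φ ∧' ψ) ∷ Γ ⊢ Δ ⟩ →
       Proof C ⟨ R ∣ T ∣ (w , φ) ∷ (w , ψ) ∷ Γ ⊢ Δ ⟩ →
       Proof C ⟨ R ∣ T ∣ (w , φ ∧' ψ) ∷ Γ ⊢ Δ ⟩
  ∧R : ∀ {R T Γ Δ w φ ψ} →
       IsSequent ⟨ R ∣ T ∣ Γ ⊢ (w , φ ∧' ψ) ∷ Δ ⟩ →
       Proof C ⟨ R ∣ T ∣ Γ ⊢ (w , φ) ∷ Δ ⟩ →
       Proof C ⟨ R ∣ T ∣ Γ ⊢ (w , ψ) ∷ Δ ⟩ →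
       Proof C ⟨ R ∣ T ∣ Γ ⊢ (w , φ ∧' ψ) ∷ Δ ⟩
  ∨L : ∀ {R T Γ Δ w φ ψ} →
       IsSequent ⟨ R ∣ T ∣ (w , φ ∨' ψ) ∷ Γ ⊢ Δ ⟩ →
       Proof C ⟨ R ∣ T ∣ (w , φ) ∷ Γ ⊢ Δ ⟩ →
       Proof C ⟨ R ∣ T ∣ (w , ψ) ∷ Γ ⊢ Δ ⟩ →
       Proof C ⟨ R ∣ T ∣ (w , φ ∨' ψ) ∷ Γ ⊢ Δ ⟩
  ∨R : ∀ {R T Γ Δ w φ ψ} →
       IsSequent ⟨ R ∣ T ∣ Γ ⊢ (w , φ ∨' ψ) ∷ Δ ⟩ →
       Proof C ⟨ R ∣ T ∣ Γ ⊢ (w , φ) ∷ (w , ψ) ∷ Δ ⟩ →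
       Proof C ⟨ R ∣ T ∣ Γ ⊢ (w , φ ∨' ψ) ∷ Δ ⟩
  ⇒L : ∀ {R T Γ Δ w u φ ψ} →
       IsSequent ⟨ R ∣ T ∣ (w , φ ⇒ ψ) ∷ Γ ⊢ Δ ⟩ →
       R ⊢ w ↠ u →
       Proof C ⟨ R ∣ T ∣ (w , φ ⇒ ψ) ∷ Γ ⊢ (u , φ) ∷ Δ ⟩ →
       Proof C ⟨ R ∣ T ∣ (w , φ ⇒ ψ) ∷ (u , ψ) ∷ Γ ⊢ Δ ⟩ →
       Proof C ⟨ R ∣ T ∣ (w , φ ⇒ ψ) ∷ Γ ⊢ Δ ⟩
  ⇒R : ∀ {R T Γ Δ w u φ ψ} →
       IsSequent ⟨ R ∣ T ∣ Γ ⊢ (w , φ ⇒ ψ) ∷ Δ ⟩ →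
       FreshL u ⟨ R ∣ T ∣ Γ ⊢ (w , φ ⇒ ψ) ∷ Δ ⟩ →
       Proof C ⟨ (w , u) ∷ R ∣ T ∣ (u , φ) ∷ Γ ⊢ (u , ψ) ∷ Δ ⟩ →
       Proof C ⟨ R ∣ T ∣ Γ ⊢ (w , φ ⇒ ψ) ∷ Δ ⟩
  -<L : ∀ {R T Γ Δ w u φ ψ} →
       IsSequent ⟨ R ∣ T ∣ (w , φ -< ψ) ∷ Γ ⊢ Δ ⟩ →
       FreshL u ⟨ R ∣ T ∣ (w , φ -< ψ) ∷ Γ ⊢ Δ ⟩ →
       Proof C ⟨ (u , w) ∷ R ∣ T ∣ (u , φ) ∷ Γ ⊢ (u , ψ) ∷ Δ ⟩ →
       Proof C ⟨ R ∣ T ∣ (w , φ -< ψ) ∷ Γ ⊢ Δ ⟩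
  -<R : ∀ {R T Γ Δ w u φ ψ} →
       IsSequent ⟨ R ∣ T ∣ Γ ⊢ (u , φ -< ψ) ∷ Δ ⟩ →
       R ⊢ w ↠ u →
       Proof C ⟨ R ∣ T ∣ Γ ⊢ (u , φ -< ψ) ∷ (w , φ) ∷ Δ ⟩ →
       Proof C ⟨ R ∣ T ∣ (w , ψ) ∷ Γ ⊢ (u , φ -< ψ) ∷ Δ ⟩ →
       Proof C ⟨ R ∣ T ∣ Γ ⊢ (u , φ -< ψ) ∷ Δ ⟩
  ∃L : ∀ {R T Γ Δ w x y φ} →
       IsSequent ⟨ R ∣ T ∣ (w , ex x φ) ∷ Γ ⊢ Δ ⟩ →
       FreshV y ⟨ R ∣ T ∣ (w , ex x φ) ∷ Γ ⊢ Δ ⟩ →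
       Proof C ⟨ R ∣ (w , y) ∷ T ∣ (w , φ [ var y / x ]) ∷ Γ ⊢ Δ ⟩ →
       Proof C ⟨ R ∣ T ∣ (w , ex x φ) ∷ Γ ⊢ Δ ⟩
  ∃R : ∀ {R T Γ Δ w x φ} (t : Term) →
       IsSequent ⟨ R ∣ T ∣ Γ ⊢ (w , ex x φ) ∷ Δ ⟩ →
       Avail C R T w t →
       Proof C ⟨ R ∣ T ∣ Γ ⊢ (w , ex x φ) ∷ (w , φ [ t / x ]) ∷ Δ ⟩ →
       Proof C ⟨ R ∣ T ∣ Γ ⊢ (w , ex x φ) ∷ Δ ⟩
  ∀L : ∀ {R T Γ Δ w u x φ} (t : Term) →
       IsSequent ⟨ R ∣ T ∣ (w , all x φ) ∷ Γ ⊢ Δ ⟩ →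
       R ⊢ w ↠ u →
       Avail C R T u t →
       Proof C ⟨ R ∣ T ∣ (w , all x φ) ∷ (u , φ [ t / x ]) ∷ Γ ⊢ Δ ⟩ →
       Proof C ⟨ R ∣ T ∣ (w , all x φ) ∷ Γ ⊢ Δ ⟩
  ∀R : ∀ {R T Γ Δ w u x y φ} →
       IsSequent ⟨ R ∣ T ∣ Γ ⊢ (w , all x φ) ∷ Δ ⟩ →
       FreshL u ⟨ R ∣ T ∣ Γ ⊢ (w , all x φ) ∷ Δ ⟩ →
       FreshV y ⟨ R ∣ T ∣ Γ ⊢ (w , all x φ) ∷ Δ ⟩ →
       Proof C ⟨ (w , u) ∷ R ∣ (u , y) ∷ T ∣ Γ ⊢ (u , φ [ var y / x ]) ∷ Δ ⟩ →
       Proof C ⟨ R ∣ T ∣ Γ ⊢ (w , all x φ) ∷ Δ ⟩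
  -- (ds), only in LBIQ(ID); VT(t⃗) taken as a set (duplicates removed)
  ds : ∀ {R T Γ Δ w p ts} →
       C ≡ ID →
       IsSequent ⟨ R ∣ T ∣ (w , atom p ts) ∷ Γ ⊢ Δ ⟩ →
       Proof C ⟨ R ∣ map (λ x → (w , x)) (deduplicate _≟_ (vts ts)) ++ T ∣ (w , atom p ts) ∷ Γ ⊢ Δ ⟩ →
       Proof C ⟨ R ∣ T ∣ (w , atom p ts) ∷ Γ ⊢ Δ ⟩

-- height = length (number of rule instances) of the longest branch minus one;
-- leaves have height 0; `perm` nodes are not counted
height : ∀ {C s} → Proof C s → ℕ
height (perm _ π) = height π
height (ax _ _) = 0
height (⊥L _) = 0
height (⊤R _) = 0
height (∧L _ π) = suc (height π)
height (∧R _ π ρ) = suc (height π ⊔ height ρ)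
height (∨L _ π ρ) = suc (height π ⊔ height ρ)
height (∨R _ π) = suc (height π)
height (⇒L _ _ π ρ) = suc (height π ⊔ height ρ)
height (⇒R _ _ π) = suc (height π)
height (-<L _ _ π) = suc (height π)
height (-<R _ _ π ρ) = suc (height π ⊔ height ρ)
height (∃L _ _ π) = suc (height π)
height (∃R _ _ _ π) = suc (height π)
height (∀L _ _ _ _ π) = suc (height π)
height (∀R _ _ _ π) = suc (height π)
height (ds _ _ π) = suc (height π)

module Submission where

-- Induction on (a bound for) the height of the proof, adding w : x to every sequent.
-- Since w is already a label of the conclusion, label side conditions are preserved. The only
-- obstacle is an eigenvariable y of (∃L) or (∀R) that equals x: there the premise is first
-- renamed along the transposition of y with a variable fresh for the conclusion and distinct
-- from x, which costs no height because renaming variables along any injective map is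
-- height-preserving admissible. Capture-avoiding substitution may pick different bound names
-- before and after renaming, so formulas are compared up to α-equivalence, through their
-- de Bruijn translations.

open import Defs
open import Data.Nat using (ℕ; zero; suc; _≤_; _⊔_; s≤s; z≤n)
open import Data.Nat.Properties
  using (_≟_; ≤-refl; ≤-trans; m≤m⊔n; m≤n⊔m; n≮n; ⊔-mono-≤; m⊔n≤o⇒m≤o; m⊔n≤o⇒n≤o)
open import Data.Bool using (true; false; if_then_else_)
open import Data.Bool.Properties using (∨-zeroʳ; if-float)
open import Data.List using (List; []; _∷_; _++_; map; concatMap; filter; deduplicate)
open import Data.List.Properties
  using ( map-++; map-∘; map-id-local; concatMap-++; concatMap-pure; concatMap-map
        ; filter-accept; filter-reject; ++-identityʳ; ∷-injective)
open import Data.List.Membership.Propositional using (_∈_; _∉_)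
open import Data.List.Membership.Propositional.Properties
  using (∈-++⁺ˡ; ∈-++⁺ʳ; ∈-++⁻; ∈-map⁺; ∈-map⁻; ∈-concatMap⁺; ∈-filter⁺)
open import Data.List.Relation.Unary.Any as Any using (here; there)
open import Data.List.Relation.Unary.All as All using ([]; _∷_)
import Data.List.Relation.Unary.All.Properties as All
open import Data.List.Relation.Binary.Pointwise as Pointwise using (Pointwise; []; _∷_)
open import Data.List.Relation.Binary.Permutation.Propositional as ↭
  using (_↭_; ↭-refl; ↭-sym; ↭-trans; ↭-reflexive)
open import Data.List.Relation.Binary.Permutation.Propositional.Properties as ↭
  using (++⁺ˡ; shifts)
open import Data.Product as Σ using (Σ; ∃-syntax; _×_; _,_; proj₁; proj₂; map₂)
open import Data.Sum using (_⊎_; inj₁; inj₂; [_,_]′)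
open import Data.Empty using (⊥-elim)
open import Data.Unit using (tt)
open import Function using (id; _∘_; case_of_)
open import Function.Definitions using (Injective)
open import Relation.Nullary using (¬_; ¬?; does; yes; no)
open import Relation.Nullary.Decidable using (dec-true; dec-false)
open import Relation.Binary.PropositionalEquality
  using (_≡_; _≢_; refl; sym; trans; cong; cong₂; subst₂; module ≡-Reasoning)
  renaming (subst to ≡-subst)

concatMap-↭ : ∀ {A B : Set} (f : A → List B) {xs ys} → xs ↭ ys → concatMap f xs ↭ concatMap f ys
concatMap-↭ f ↭.refl = ↭-refl
concatMap-↭ f (↭.prep x p) = ++⁺ˡ (f x) (concatMap-↭ f p)
concatMap-↭ f (↭.swap x y p) =
  ↭-trans (shifts (f x) (f y)) (++⁺ˡ (f y) (++⁺ˡ (f x) (concatMap-↭ f p)))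
concatMap-↭ f (↭.trans p q) = ↭-trans (concatMap-↭ f p) (concatMap-↭ f q)

Pointwise-↭ : ∀ {A B : Set} {_∼_ : A → B → Set} {xs ys ys′} →
  ys ↭ ys′ → Pointwise _∼_ xs ys′ → ∃[ xs′ ] xs′ ↭ xs × Pointwise _∼_ xs′ ys
Pointwise-↭ ↭.refl rs = _ , ↭-refl , rs
Pointwise-↭ (↭.prep y p) (r ∷ rs) with Pointwise-↭ p rs
... | _ , q , rs′ = _ , ↭.prep _ q , r ∷ rs′
Pointwise-↭ (↭.swap y z p) (r ∷ s ∷ rs) with Pointwise-↭ p rs
... | _ , q , rs′ = _ , ↭.swap _ _ q , s ∷ r ∷ rs′
Pointwise-↭ (↭.trans p q) rs with Pointwise-↭ q rs
... | _ , q′ , rs′ with Pointwise-↭ p rs′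
... | _ , p′ , rs″ = _ , ↭-trans p′ q′ , rs″

∈-concatMap-∈ : ∀ {A B : Set} (f : A → List B) {x xs y} → x ∈ xs → y ∈ f x → y ∈ concatMap f xs
∈-concatMap-∈ f x∈xs y∈fx = ∈-concatMap⁺ f (Any.map (λ { refl → y∈fx }) x∈xs)

≤-maxList : ∀ {n ns} → n ∈ ns → n ≤ maxList ns
≤-maxList {ns = m ∷ ns} (here refl) = m≤m⊔n m (maxList ns)
≤-maxList {ns = m ∷ ns} (there n∈ns) = ≤-trans (≤-maxList n∈ns) (m≤n⊔m m (maxList ns))

suc-maxList-∉ : ∀ ns → suc (maxList ns) ∉ ns
suc-maxList-∉ ns m∈ns = n≮n (maxList ns) (≤-maxList m∈ns)

memb-complete : ∀ {y ys} → y ∈ ys → memb y ys ≡ true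
memb-complete {y} (here refl) rewrite dec-true (y ≟ y) refl = refl
memb-complete {y} {v ∷ _} (there y∈ys) rewrite memb-complete y∈ys = ∨-zeroʳ (does (y ≟ v))

module _ {f : ℕ → ℕ} (f-injective : Injective _≡_ _≡_ f) where

  map-filter-≢ : ∀ x xs →
    map f (filter (λ y → ¬? (x ≟ y)) xs) ≡ filter (λ y → ¬? (f x ≟ y)) (map f xs)
  map-filter-≢ x [] = refl
  map-filter-≢ x (y ∷ xs) with x ≟ y
  ... | yes refl
    rewrite filter-reject (λ y → ¬? (x ≟ y)) {xs = xs} (λ x≢x → x≢x refl)
          | filter-reject (λ y → ¬? (f x ≟ y)) {xs = map f xs} (λ fx≢fx → fx≢fx refl)
    = map-filter-≢ x xs
  ... | no x≢y
    rewrite filter-accept (λ y → ¬? (x ≟ y)) {xs = xs} x≢y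
          | filter-accept (λ y → ¬? (f x ≟ y)) {xs = map f xs} (x≢y ∘ f-injective)
    = cong (f y ∷_) (map-filter-≢ x xs)

  map-deduplicate : ∀ xs → map f (deduplicate _≟_ xs) ≡ deduplicate _≟_ (map f xs)
  map-deduplicate [] = refl
  map-deduplicate (x ∷ xs) = cong (f x ∷_) (begin
    map f (filter (λ y → ¬? (x ≟ y)) (deduplicate _≟_ xs))
      ≡⟨ map-filter-≢ x (deduplicate _≟_ xs) ⟩
    filter (λ y → ¬? (f x ≟ y)) (map f (deduplicate _≟_ xs))
      ≡⟨ cong (filter (λ y → ¬? (f x ≟ y))) (map-deduplicate xs) ⟩
    filter (λ y → ¬? (f x ≟ y)) (deduplicate _≟_ (map f xs)) ∎)
    where open ≡-Reasoning

-- Definitionally the same function as σ [ y ↦ t ] of Defs, so the lemmas below evaluate both.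
_[_≔_] : {A : Set} → (Var → A) → Var → A → Var → A
(f [ y ≔ a ]) v = if does (v ≟ y) then a else f v

≔-≡ : ∀ {A : Set} (f : Var → A) y a → (f [ y ≔ a ]) y ≡ a
≔-≡ f y a rewrite dec-true (y ≟ y) refl = refl

≔-≢ : ∀ {A : Set} (f : Var → A) {y v} a → v ≢ y → (f [ y ≔ a ]) v ≡ f v
≔-≢ f {y} {v} a v≢y rewrite dec-false (v ≟ y) v≢y = refl

binderVar-avoids : ∀ σ y fvs {v} → v ∈ fvs → binderVar σ y fvs ∉ vt (σ v)
binderVar-avoids σ y fvs v∈fvs z∈σv = avoids (∈-concatMap-∈ (λ v → vt (σ v)) v∈fvs z∈σv)
  where
  avoids : binderVar σ y fvs ∉ concatMap (λ v → vt (σ v)) fvs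
  avoids with memb y (concatMap (λ v → vt (σ v)) fvs) in eq
  ... | true = suc-maxList-∉ _
  ... | false = λ y∈ → case trans (sym eq) (memb-complete y∈) of λ ()

-- Nameless formulas

-- De Bruijn levels: bound k is the variable of the quantifier at depth k, counted from the outside.
data DTerm : Set where
  free  : Var → DTerm
  bound : ℕ → DTerm
  dfun  : FunSym → List DTerm → DTerm

data Conn : Set where
  ∧c ∨c -<c ⇒c : Conn

data Quant : Set where
  ∃q ∀q : Quant

data DFormula : Set where
  datom  : PredSym → List DTerm → DFormula
  d⊥ d⊤  : DFormula
  dbin   : Conn → DFormula → DFormula → DFormula
  dquant : Quant → DFormula → DFormula

binF : Conn → Formula → Formula → Formula
binF ∧c = _∧'_
binF ∨c = _∨'_
binF -<c = _-<_
binF ⇒c = _⇒_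

quantF : Quant → Var → Formula → Formula
quantF ∃q = ex
quantF ∀q = all

Env : Set
Env = Var → DTerm

mutual
  dbT : Env → Term → DTerm
  dbT ρ (var x) = ρ x
  dbT ρ (fun f ts) = dfun f (dbTs ρ ts)

  dbTs : Env → List Term → List DTerm
  dbTs ρ [] = []
  dbTs ρ (t ∷ ts) = dbT ρ t ∷ dbTs ρ ts

db : ℕ → Env → Formula → DFormula
db k ρ (atom p ts) = datom p (dbTs ρ ts)
db k ρ ⊥' = d⊥
db k ρ ⊤' = d⊤
db k ρ (φ ∧' ψ) = dbin ∧c (db k ρ φ) (db k ρ ψ)
db k ρ (φ ∨' ψ) = dbin ∨c (db k ρ φ) (db k ρ ψ)
db k ρ (φ -< ψ) = dbin -<c (db k ρ φ) (db k ρ ψ)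
db k ρ (φ ⇒ ψ) = dbin ⇒c (db k ρ φ) (db k ρ ψ)
db k ρ (ex y φ) = dquant ∃q (db (suc k) (ρ [ y ≔ bound k ]) φ)
db k ρ (all y φ) = dquant ∀q (db (suc k) (ρ [ y ≔ bound k ]) φ)

≔-pointwise : ∀ {A B : Set} (_∼_ : A → B → Set) {f : Var → A} {g : Var → B} y {a b} →
  a ∼ b → ∀ {xs} → (∀ {v} → v ∈ filter (λ v → ¬? (v ≟ y)) xs → f v ∼ g v) →
  ∀ {v} → v ∈ xs → (f [ y ≔ a ]) v ∼ (g [ y ≔ b ]) v
≔-pointwise _∼_ {f} {g} y {a} {b} a∼b agree {v} v∈xs with v ≟ y
... | yes refl = subst₂ _∼_ (sym (≔-≡ f v a)) (sym (≔-≡ g v b)) a∼b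
... | no v≢y = subst₂ _∼_ (sym (≔-≢ f a v≢y)) (sym (≔-≢ g b v≢y))
                 (agree (∈-filter⁺ (λ v → ¬? (v ≟ y)) v∈xs v≢y))

mutual
  dbT-cong : ∀ {ρ ρ′} t → (∀ {v} → v ∈ vt t → ρ v ≡ ρ′ v) → dbT ρ t ≡ dbT ρ′ t
  dbT-cong (var x) agree = agree (here refl)
  dbT-cong (fun f ts) agree = cong (dfun f) (dbTs-cong ts agree)

  dbTs-cong : ∀ {ρ ρ′} ts → (∀ {v} → v ∈ vts ts → ρ v ≡ ρ′ v) → dbTs ρ ts ≡ dbTs ρ′ ts
  dbTs-cong [] agree = refl
  dbTs-cong (t ∷ ts) agree =
    cong₂ _∷_ (dbT-cong t (agree ∘ ∈-++⁺ˡ)) (dbTs-cong ts (agree ∘ ∈-++⁺ʳ (vt t)))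

db-cong : ∀ k {ρ ρ′} φ → (∀ {v} → v ∈ fv φ → ρ v ≡ ρ′ v) → db k ρ φ ≡ db k ρ′ φ
db-cong k (atom p ts) agree = cong (datom p) (dbTs-cong ts agree)
db-cong k ⊥' agree = refl
db-cong k ⊤' agree = refl
db-cong k (φ ∧' ψ) agree =
  cong₂ (dbin ∧c) (db-cong k φ (agree ∘ ∈-++⁺ˡ)) (db-cong k ψ (agree ∘ ∈-++⁺ʳ (fv φ)))
db-cong k (φ ∨' ψ) agree =
  cong₂ (dbin ∨c) (db-cong k φ (agree ∘ ∈-++⁺ˡ)) (db-cong k ψ (agree ∘ ∈-++⁺ʳ (fv φ)))
db-cong k (φ -< ψ) agree =
  cong₂ (dbin -<c) (db-cong k φ (agree ∘ ∈-++⁺ˡ)) (db-cong k ψ (agree ∘ ∈-++⁺ʳ (fv φ)))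
db-cong k (φ ⇒ ψ) agree =
  cong₂ (dbin ⇒c) (db-cong k φ (agree ∘ ∈-++⁺ˡ)) (db-cong k ψ (agree ∘ ∈-++⁺ʳ (fv φ)))
db-cong k (ex y φ) agree = cong (dquant ∃q) (db-cong (suc k) φ (≔-pointwise _≡_ y refl agree))
db-cong k (all y φ) agree = cong (dquant ∀q) (db-cong (suc k) φ (≔-pointwise _≡_ y refl agree))

mutual
  dbT-tsub : ∀ ρ σ t → dbT ρ (tsub σ t) ≡ dbT (dbT ρ ∘ σ) t
  dbT-tsub ρ σ (var x) = refl
  dbT-tsub ρ σ (fun f ts) = cong (dfun f) (dbTs-tsubs ρ σ ts)

  dbTs-tsubs : ∀ ρ σ ts → dbTs ρ (tsubs σ ts) ≡ dbTs (dbT ρ ∘ σ) ts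
  dbTs-tsubs ρ σ [] = refl
  dbTs-tsubs ρ σ (t ∷ ts) = cong₂ _∷_ (dbT-tsub ρ σ t) (dbTs-tsubs ρ σ ts)

mutual
  db-subst : ∀ k ρ σ φ → db k ρ (subst σ φ) ≡ db k (dbT ρ ∘ σ) φ
  db-subst k ρ σ (atom p ts) = cong (datom p) (dbTs-tsubs ρ σ ts)
  db-subst k ρ σ ⊥' = refl
  db-subst k ρ σ ⊤' = refl
  db-subst k ρ σ (φ ∧' ψ) = cong₂ (dbin ∧c) (db-subst k ρ σ φ) (db-subst k ρ σ ψ)
  db-subst k ρ σ (φ ∨' ψ) = cong₂ (dbin ∨c) (db-subst k ρ σ φ) (db-subst k ρ σ ψ)
  db-subst k ρ σ (φ -< ψ) = cong₂ (dbin -<c) (db-subst k ρ σ φ) (db-subst k ρ σ ψ)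
  db-subst k ρ σ (φ ⇒ ψ) = cong₂ (dbin ⇒c) (db-subst k ρ σ φ) (db-subst k ρ σ ψ)
  db-subst k ρ σ (ex y φ) = cong (dquant ∃q) (db-subst-body k ρ σ y φ)
  db-subst k ρ σ (all y φ) = cong (dquant ∀q) (db-subst-body k ρ σ y φ)

  db-subst-body : ∀ k ρ σ y φ → let z = binderVar σ y (filter (λ v → ¬? (v ≟ y)) (fv φ)) in
    db (suc k) (ρ [ z ≔ bound k ]) (subst (σ [ y ↦ var z ]) φ) ≡
    db (suc k) ((dbT ρ ∘ σ) [ y ≔ bound k ]) φ
  db-subst-body k ρ σ y φ = trans (db-subst (suc k) _ _ φ) (db-cong (suc k) φ agree)
    where
    z = binderVar σ y (filter (λ v → ¬? (v ≟ y)) (fv φ))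
    agree : ∀ {v} → v ∈ fv φ →
      dbT (ρ [ z ≔ bound k ]) ((σ [ y ↦ var z ]) v) ≡ ((dbT ρ ∘ σ) [ y ≔ bound k ]) v
    agree {v} v∈φ with v ≟ y
    ... | yes refl = begin
      dbT (ρ [ z ≔ bound k ]) ((σ [ v ↦ var z ]) v)  ≡⟨ cong (dbT _) (≔-≡ σ v (var z)) ⟩
      (ρ [ z ≔ bound k ]) z                           ≡⟨ ≔-≡ ρ z (bound k) ⟩
      bound k                                         ≡⟨ sym (≔-≡ (dbT ρ ∘ σ) v (bound k)) ⟩
      ((dbT ρ ∘ σ) [ v ≔ bound k ]) v                 ∎
      where open ≡-Reasoning
    ... | no v≢y = begin
      dbT (ρ [ z ≔ bound k ]) ((σ [ y ↦ var z ]) v)  ≡⟨ cong (dbT _) (≔-≢ σ (var z) v≢y) ⟩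
      dbT (ρ [ z ≔ bound k ]) (σ v)
        ≡⟨ dbT-cong (σ v) (λ u∈σv → ≔-≢ ρ (bound k) (λ { refl → z∉σv u∈σv })) ⟩
      dbT ρ (σ v)                                     ≡⟨ sym (≔-≢ (dbT ρ ∘ σ) (bound k) v≢y) ⟩
      ((dbT ρ ∘ σ) [ y ≔ bound k ]) v                 ∎
      where
      open ≡-Reasoning
      z∉σv : z ∉ vt (σ v)
      z∉σv = binderVar-avoids σ y _ (∈-filter⁺ (λ v → ¬? (v ≟ y)) v∈φ v≢y)

mutual
  instT : (ℕ → DTerm) → DTerm → DTerm
  instT h (free x) = free x
  instT h (bound i) = h i
  instT h (dfun f es) = dfun f (instTs h es)

  instTs : (ℕ → DTerm) → List DTerm → List DTerm
  instTs h [] = []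
  instTs h (e ∷ es) = instT h e ∷ instTs h es

instF : (ℕ → DTerm) → DFormula → DFormula
instF h (datom p es) = datom p (instTs h es)
instF h d⊥ = d⊥
instF h d⊤ = d⊤
instF h (dbin c a b) = dbin c (instF h a) (instF h b)
instF h (dquant q a) = dquant q (instF h a)

inst₀ : DTerm → ℕ → DTerm
inst₀ d zero = d
inst₀ d (suc i) = bound i

mutual
  dbT-inst : ∀ h {ρ ρ′} t → (∀ {v} → v ∈ vt t → instT h (ρ v) ≡ ρ′ v) →
    instT h (dbT ρ t) ≡ dbT ρ′ t
  dbT-inst h (var x) agree = agree (here refl)
  dbT-inst h (fun f ts) agree = cong (dfun f) (dbTs-inst h ts agree)

  dbTs-inst : ∀ h {ρ ρ′} ts → (∀ {v} → v ∈ vts ts → instT h (ρ v) ≡ ρ′ v) →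
    instTs h (dbTs ρ ts) ≡ dbTs ρ′ ts
  dbTs-inst h [] agree = refl
  dbTs-inst h (t ∷ ts) agree =
    cong₂ _∷_ (dbT-inst h t (agree ∘ ∈-++⁺ˡ)) (dbTs-inst h ts (agree ∘ ∈-++⁺ʳ (vt t)))

db-inst₀ : ∀ d k {ρ ρ′} φ → (∀ {v} → v ∈ fv φ → instT (inst₀ d) (ρ v) ≡ ρ′ v) →
  instF (inst₀ d) (db (suc k) ρ φ) ≡ db k ρ′ φ
db-inst₀ d k (atom p ts) agree = cong (datom p) (dbTs-inst (inst₀ d) ts agree)
db-inst₀ d k ⊥' agree = refl
db-inst₀ d k ⊤' agree = refl
db-inst₀ d k (φ ∧' ψ) agree =
  cong₂ (dbin ∧c) (db-inst₀ d k φ (agree ∘ ∈-++⁺ˡ)) (db-inst₀ d k ψ (agree ∘ ∈-++⁺ʳ (fv φ)))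
db-inst₀ d k (φ ∨' ψ) agree =
  cong₂ (dbin ∨c) (db-inst₀ d k φ (agree ∘ ∈-++⁺ˡ)) (db-inst₀ d k ψ (agree ∘ ∈-++⁺ʳ (fv φ)))
db-inst₀ d k (φ -< ψ) agree =
  cong₂ (dbin -<c) (db-inst₀ d k φ (agree ∘ ∈-++⁺ˡ)) (db-inst₀ d k ψ (agree ∘ ∈-++⁺ʳ (fv φ)))
db-inst₀ d k (φ ⇒ ψ) agree =
  cong₂ (dbin ⇒c) (db-inst₀ d k φ (agree ∘ ∈-++⁺ˡ)) (db-inst₀ d k ψ (agree ∘ ∈-++⁺ʳ (fv φ)))
db-inst₀ d k {ρ} (ex y φ) agree = cong (dquant ∃q) (db-inst₀ d (suc k) φ
  (≔-pointwise (λ a b → instT (inst₀ d) a ≡ b) {f = ρ} y refl agree))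
db-inst₀ d k {ρ} (all y φ) agree = cong (dquant ∀q) (db-inst₀ d (suc k) φ
  (≔-pointwise (λ a b → instT (inst₀ d) a ≡ b) {f = ρ} y refl agree))

db-instance : ∀ k ρ φ t x → db k ρ (φ [ t / x ]) ≡ db k (ρ [ x ≔ dbT ρ t ]) φ
db-instance k ρ φ t x =
  trans (db-subst k ρ (var [ x ↦ t ]) φ) (db-cong k φ (λ {v} _ → if-float (dbT ρ) (does (v ≟ x))))

db-abstract-instance : ∀ (g : Var → Var) x φ t →
  instF (inst₀ (dbT (free ∘ g) t)) (db 1 ((free ∘ g) [ x ≔ bound 0 ]) φ) ≡
  db 0 (free ∘ g) (φ [ t / x ])
db-abstract-instance g x φ t =
  trans (db-inst₀ _ 0 φ (λ {v} _ → if-float (instT (inst₀ _)) (does (v ≟ x))))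
        (sym (db-instance 0 (free ∘ g) φ t x))

-- ψ is α-equivalent to φ with its free variables renamed along r.
_≈[_]_ : Formula → (Var → Var) → Formula → Set
ψ ≈[ r ] φ = db 0 free ψ ≡ db 0 (free ∘ r) φ

dquant-injective : ∀ {q a b} → dquant q a ≡ dquant q b → a ≡ b
dquant-injective refl = refl

-- Both instances are the common nameless body instantiated at the same nameless term.
instance-≈ : ∀ q {r x′ φ′ x φ t′ t} → quantF q x′ φ′ ≈[ r ] quantF q x φ →
  dbT free t′ ≡ dbT (free ∘ r) t → (φ′ [ t′ / x′ ]) ≈[ r ] (φ [ t / x ])
instance-≈ q {r} {x′} {φ′} {x} {φ} {t′} {t} e t′≈t = begin
  db 0 free (φ′ [ t′ / x′ ])
    ≡⟨ sym (db-abstract-instance id x′ φ′ t′) ⟩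
  instF (inst₀ (dbT free t′)) (db 1 (free [ x′ ≔ bound 0 ]) φ′)
    ≡⟨ cong₂ (instF ∘ inst₀) t′≈t (bodies q e) ⟩
  instF (inst₀ (dbT (free ∘ r) t)) (db 1 ((free ∘ r) [ x ≔ bound 0 ]) φ)
    ≡⟨ db-abstract-instance r x φ t ⟩
  db 0 (free ∘ r) (φ [ t / x ]) ∎
  where
  open ≡-Reasoning
  bodies : ∀ q → quantF q x′ φ′ ≈[ r ] quantF q x φ →
    db 1 (free [ x′ ≔ bound 0 ]) φ′ ≡ db 1 ((free ∘ r) [ x ≔ bound 0 ]) φ
  bodies ∃q = dquant-injective
  bodies ∀q = dquant-injective

db-atom⁻ : ∀ {k ρ p es} ψ → db k ρ ψ ≡ datom p es → ∃[ ts ] ψ ≡ atom p ts × dbTs ρ ts ≡ es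
db-atom⁻ (atom p ts) refl = ts , refl , refl
db-atom⁻ ⊥' ()
db-atom⁻ ⊤' ()
db-atom⁻ (_ ∧' _) ()
db-atom⁻ (_ ∨' _) ()
db-atom⁻ (_ -< _) ()
db-atom⁻ (_ ⇒ _) ()
db-atom⁻ (ex _ _) ()
db-atom⁻ (all _ _) ()

db-⊥⁻ : ∀ {k ρ} ψ → db k ρ ψ ≡ d⊥ → ψ ≡ ⊥'
db-⊥⁻ (atom _ _) ()
db-⊥⁻ ⊥' refl = refl
db-⊥⁻ ⊤' ()
db-⊥⁻ (_ ∧' _) ()
db-⊥⁻ (_ ∨' _) ()
db-⊥⁻ (_ -< _) ()
db-⊥⁻ (_ ⇒ _) ()
db-⊥⁻ (ex _ _) ()
db-⊥⁻ (all _ _) ()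

db-⊤⁻ : ∀ {k ρ} ψ → db k ρ ψ ≡ d⊤ → ψ ≡ ⊤'
db-⊤⁻ (atom _ _) ()
db-⊤⁻ ⊥' ()
db-⊤⁻ ⊤' refl = refl
db-⊤⁻ (_ ∧' _) ()
db-⊤⁻ (_ ∨' _) ()
db-⊤⁻ (_ -< _) ()
db-⊤⁻ (_ ⇒ _) ()
db-⊤⁻ (ex _ _) ()
db-⊤⁻ (all _ _) ()

db-bin⁻ : ∀ {k ρ c a b} ψ → db k ρ ψ ≡ dbin c a b →
  ∃[ ψ₁ ] ∃[ ψ₂ ] ψ ≡ binF c ψ₁ ψ₂ × db k ρ ψ₁ ≡ a × db k ρ ψ₂ ≡ b
db-bin⁻ (atom _ _) ()
db-bin⁻ ⊥' ()
db-bin⁻ ⊤' ()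
db-bin⁻ (ψ₁ ∧' ψ₂) refl = ψ₁ , ψ₂ , refl , refl , refl
db-bin⁻ (ψ₁ ∨' ψ₂) refl = ψ₁ , ψ₂ , refl , refl , refl
db-bin⁻ (ψ₁ -< ψ₂) refl = ψ₁ , ψ₂ , refl , refl , refl
db-bin⁻ (ψ₁ ⇒ ψ₂) refl = ψ₁ , ψ₂ , refl , refl , refl
db-bin⁻ (ex _ _) ()
db-bin⁻ (all _ _) ()

db-quant⁻ : ∀ {k ρ q a} ψ → db k ρ ψ ≡ dquant q a → ∃[ y ] ∃[ ψ₁ ] ψ ≡ quantF q y ψ₁
db-quant⁻ (atom _ _) ()
db-quant⁻ ⊥' ()
db-quant⁻ ⊤' ()
db-quant⁻ (_ ∧' _) ()
db-quant⁻ (_ ∨' _) ()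
db-quant⁻ (_ -< _) ()
db-quant⁻ (_ ⇒ _) ()
db-quant⁻ (ex y ψ₁) refl = y , ψ₁ , refl
db-quant⁻ (all y ψ₁) refl = y , ψ₁ , refl

dfun-injective : ∀ {f g es es′} → dfun f es ≡ dfun g es′ → f ≡ g × es ≡ es′
dfun-injective refl = refl , refl

mutual
  dbT-free-injective : ∀ t t′ → dbT free t ≡ dbT free t′ → t ≡ t′
  dbT-free-injective (var x) (var .x) refl = refl
  dbT-free-injective (var _) (fun _ _) ()
  dbT-free-injective (fun _ _) (var _) ()
  dbT-free-injective (fun f ts) (fun g ts′) e with dfun-injective e
  ... | refl , ts≡ts′ = cong (fun f) (dbTs-free-injective ts ts′ ts≡ts′)

  dbTs-free-injective : ∀ ts ts′ → dbTs free ts ≡ dbTs free ts′ → ts ≡ ts′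
  dbTs-free-injective [] [] refl = refl
  dbTs-free-injective [] (_ ∷ _) ()
  dbTs-free-injective (_ ∷ _) [] ()
  dbTs-free-injective (t ∷ ts) (t′ ∷ ts′) e with ∷-injective e
  ... | t≡t′ , ts≡ts′ =
    cong₂ _∷_ (dbT-free-injective t t′ t≡t′) (dbTs-free-injective ts ts′ ts≡ts′)

≈-atom⁻ : ∀ {r p ts} ψ → ψ ≈[ r ] atom p ts → ψ ≡ atom p (tsubs (var ∘ r) ts)
≈-atom⁻ {r} {p} {ts} ψ e with db-atom⁻ ψ e
... | ts′ , refl , ts′≈ts =
  cong (atom p) (dbTs-free-injective ts′ _ (trans ts′≈ts (sym (dbTs-tsubs free (var ∘ r) ts))))

mutual
  freesT : DTerm → List Var
  freesT (free x) = x ∷ []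
  freesT (bound i) = []
  freesT (dfun f es) = freesTs es

  freesTs : List DTerm → List Var
  freesTs [] = []
  freesTs (e ∷ es) = freesT e ++ freesTs es

frees : DFormula → List Var
frees (datom p es) = freesTs es
frees d⊥ = []
frees d⊤ = []
frees (dbin c a b) = frees a ++ frees b
frees (dquant q a) = frees a

mutual
  freesT-dbT : ∀ ρ t → freesT (dbT ρ t) ≡ concatMap (freesT ∘ ρ) (vt t)
  freesT-dbT ρ (var x) = sym (++-identityʳ (freesT (ρ x)))
  freesT-dbT ρ (fun f ts) = freesTs-dbTs ρ ts

  freesTs-dbTs : ∀ ρ ts → freesTs (dbTs ρ ts) ≡ concatMap (freesT ∘ ρ) (vts ts)
  freesTs-dbTs ρ [] = refl
  freesTs-dbTs ρ (t ∷ ts) =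
    trans (cong₂ _++_ (freesT-dbT ρ t) (freesTs-dbTs ρ ts))
          (sym (concatMap-++ (freesT ∘ ρ) (vt t) (vts ts)))

concatMap-≔-bound : ∀ ρ y k xs →
  concatMap (freesT ∘ (ρ [ y ≔ bound k ])) xs ≡
  concatMap (freesT ∘ ρ) (filter (λ v → ¬? (v ≟ y)) xs)
concatMap-≔-bound ρ y k [] = refl
concatMap-≔-bound ρ y k (v ∷ xs) with v ≟ y
... | yes refl
  rewrite ≔-≡ ρ v (bound k) | filter-reject (λ u → ¬? (u ≟ v)) {xs = xs} (λ v≢v → v≢v refl)
  = concatMap-≔-bound ρ v k xs
... | no v≢y
  rewrite ≔-≢ ρ (bound k) v≢y | filter-accept (λ u → ¬? (u ≟ y)) {xs = xs} v≢y
  = cong (freesT (ρ v) ++_) (concatMap-≔-bound ρ y k xs)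

frees-db : ∀ k ρ φ → frees (db k ρ φ) ≡ concatMap (freesT ∘ ρ) (fv φ)
frees-db k ρ (atom p ts) = freesTs-dbTs ρ ts
frees-db k ρ ⊥' = refl
frees-db k ρ ⊤' = refl
frees-db k ρ (φ ∧' ψ) =
  trans (cong₂ _++_ (frees-db k ρ φ) (frees-db k ρ ψ)) (sym (concatMap-++ _ (fv φ) (fv ψ)))
frees-db k ρ (φ ∨' ψ) =
  trans (cong₂ _++_ (frees-db k ρ φ) (frees-db k ρ ψ)) (sym (concatMap-++ _ (fv φ) (fv ψ)))
frees-db k ρ (φ -< ψ) =
  trans (cong₂ _++_ (frees-db k ρ φ) (frees-db k ρ ψ)) (sym (concatMap-++ _ (fv φ) (fv ψ)))
frees-db k ρ (φ ⇒ ψ) =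
  trans (cong₂ _++_ (frees-db k ρ φ) (frees-db k ρ ψ)) (sym (concatMap-++ _ (fv φ) (fv ψ)))
frees-db k ρ (ex y φ) = trans (frees-db (suc k) _ φ) (concatMap-≔-bound ρ y k (fv φ))
frees-db k ρ (all y φ) = trans (frees-db (suc k) _ φ) (concatMap-≔-bound ρ y k (fv φ))

fv-≈ : ∀ {r} ψ φ → ψ ≈[ r ] φ → fv ψ ≡ map r (fv φ)
fv-≈ {r} ψ φ e = begin
  fv ψ                                      ≡⟨ sym (concatMap-pure (fv ψ)) ⟩
  concatMap (λ v → v ∷ []) (fv ψ)           ≡⟨ sym (frees-db 0 free ψ) ⟩
  frees (db 0 free ψ)                       ≡⟨ cong frees e ⟩
  frees (db 0 (free ∘ r) φ)                 ≡⟨ frees-db 0 (free ∘ r) φ ⟩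
  concatMap (λ v → r v ∷ []) (fv φ)         ≡⟨ sym (concatMap-map (λ v → v ∷ []) r (fv φ)) ⟩
  concatMap (λ v → v ∷ []) (map r (fv φ))   ≡⟨ concatMap-pure (map r (fv φ)) ⟩
  map r (fv φ)                              ∎
  where open ≡-Reasoning

≈-refl : ∀ {r} φ → (∀ {v} → v ∈ fv φ → r v ≡ v) → φ ≈[ r ] φ
≈-refl φ fixes = db-cong 0 φ (λ v∈φ → cong free (sym (fixes v∈φ)))

-- Height-preserving renaming of variables

mutual
  vt-rename : ∀ r t → vt (tsub (var ∘ r) t) ≡ map r (vt t)
  vt-rename r (var x) = refl
  vt-rename r (fun f ts) = vts-rename r ts

  vts-rename : ∀ r ts → vts (tsubs (var ∘ r) ts) ≡ map r (vts ts)
  vts-rename r [] = refl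
  vts-rename r (t ∷ ts) =
    trans (cong₂ _++_ (vt-rename r t) (vts-rename r ts)) (sym (map-++ r (vt t) (vts ts)))

_≋[_]_ : List LFormula → (Var → Var) → List LFormula → Set
Γ′ ≋[ r ] Γ = Pointwise (λ a b → proj₁ a ≡ proj₁ b × proj₂ a ≈[ r ] proj₂ b) Γ′ Γ

Proof≤ : Cond → Seq → ℕ → Set
Proof≤ C s n = Σ (Proof C s) (λ π → height π ≤ n)

≋-labels : ∀ {r Γ′ Γ} → Γ′ ≋[ r ] Γ → map proj₁ Γ′ ≡ map proj₁ Γ
≋-labels [] = refl
≋-labels ((l′≡l , _) ∷ Γ≋) = cong₂ _∷_ l′≡l (≋-labels Γ≋)

≋-fv : ∀ {r Γ′ Γ} → Γ′ ≋[ r ] Γ →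
  concatMap (fv ∘ proj₂) Γ′ ≡ map r (concatMap (fv ∘ proj₂) Γ)
≋-fv [] = refl
≋-fv {r} {(_ , ψ) ∷ _} {(_ , φ) ∷ _} ((_ , e) ∷ Γ≋) =
  trans (cong₂ _++_ (fv-≈ ψ φ e) (≋-fv Γ≋)) (sym (map-++ r (fv φ) _))

IsSequent-relabel : ∀ {R T Γ Δ T′ Γ′ Δ′} →
  labsTΓΔ ⟨ R ∣ T′ ∣ Γ′ ⊢ Δ′ ⟩ ≡ labsTΓΔ ⟨ R ∣ T ∣ Γ ⊢ Δ ⟩ →
  IsSequent ⟨ R ∣ T ∣ Γ ⊢ Δ ⟩ → IsSequent ⟨ R ∣ T′ ∣ Γ′ ⊢ Δ′ ⟩
IsSequent-relabel eq i rewrite eq = i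

module _ {r Γ Δ Γ′ Δ′} (R : List RelAtom) (T : List DomAtom)
         (Γ≋ : Γ′ ≋[ r ] Γ) (Δ≋ : Δ′ ≋[ r ] Δ) where

  labsTΓΔ-rename : labsTΓΔ ⟨ R ∣ map (map₂ r) T ∣ Γ′ ⊢ Δ′ ⟩ ≡ labsTΓΔ ⟨ R ∣ T ∣ Γ ⊢ Δ ⟩
  labsTΓΔ-rename = cong₂ _++_ (sym (map-∘ T)) (cong₂ _++_ (≋-labels Γ≋) (≋-labels Δ≋))

  IsSequent-rename : IsSequent ⟨ R ∣ T ∣ Γ ⊢ Δ ⟩ → IsSequent ⟨ R ∣ map (map₂ r) T ∣ Γ′ ⊢ Δ′ ⟩
  IsSequent-rename = IsSequent-relabel {R} {T} {Γ} {Δ} {map (map₂ r) T} {Γ′} {Δ′} labsTΓΔ-rename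

  FreshL-rename : ∀ {u} → FreshL u ⟨ R ∣ T ∣ Γ ⊢ Δ ⟩ → FreshL u ⟨ R ∣ map (map₂ r) T ∣ Γ′ ⊢ Δ′ ⟩
  FreshL-rename u∉ u∈ = u∉ (≡-subst (λ L → _ ∈ labsR R ++ L) labsTΓΔ-rename u∈)

  vars-rename : vars ⟨ R ∣ map (map₂ r) T ∣ Γ′ ⊢ Δ′ ⟩ ≡ map r (vars ⟨ R ∣ T ∣ Γ ⊢ Δ ⟩)
  vars-rename = begin
    map proj₂ (map (map₂ r) T) ++ concatMap (fv ∘ proj₂) (Γ′ ++ Δ′)
      ≡⟨ cong₂ _++_ (trans (sym (map-∘ T)) (map-∘ T)) (≋-fv (Pointwise.++⁺ Γ≋ Δ≋)) ⟩
    map r (map proj₂ T) ++ map r (concatMap (fv ∘ proj₂) (Γ ++ Δ))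
      ≡⟨ sym (map-++ r (map proj₂ T) _) ⟩
    map r (vars ⟨ R ∣ T ∣ Γ ⊢ Δ ⟩) ∎
    where open ≡-Reasoning

  FreshV-rename : Injective _≡_ _≡_ r → ∀ {y} → FreshV y ⟨ R ∣ T ∣ Γ ⊢ Δ ⟩ →
    FreshV (r y) ⟨ R ∣ map (map₂ r) T ∣ Γ′ ⊢ Δ′ ⟩
  FreshV-rename r-injective y∉ ry∈ with ∈-map⁻ r (≡-subst (r _ ∈_) vars-rename ry∈)
  ... | v , v∈ , ry≡rv with r-injective ry≡rv
  ... | refl = y∉ v∈

Avail-rename : ∀ C {r R T w} t → Avail C R T w t →
  Avail C R (map (map₂ r) T) w (tsub (var ∘ r) t)
Avail-rename ID {r} t av rewrite vt-rename r t =
  All.map⁺ (All.map (λ (u , ux∈T , u↠w) → u , ∈-map⁺ (map₂ r) ux∈T , u↠w) av)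
Avail-rename CD t _ = tt

ds-rename : ∀ {r} → Injective _≡_ _≡_ r → ∀ (w : Label) ts (T : List DomAtom) →
  map (map₂ r) (map (w ,_) (deduplicate _≟_ (vts ts)) ++ T) ≡
  map (w ,_) (deduplicate _≟_ (vts (tsubs (var ∘ r) ts))) ++ map (map₂ r) T
ds-rename {r} r-injective w ts T = begin
  map (map₂ r) (map (w ,_) D ++ T)
    ≡⟨ map-++ (map₂ r) (map (w ,_) D) T ⟩
  map (map₂ r) (map (w ,_) D) ++ map (map₂ r) T
    ≡⟨ cong (_++ map (map₂ r) T) (trans (sym (map-∘ D)) (map-∘ D)) ⟩
  map (w ,_) (map r D) ++ map (map₂ r) T
    ≡⟨ cong (λ V → map (w ,_) V ++ map (map₂ r) T) renamed-D ⟩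
  map (w ,_) (deduplicate _≟_ (vts (tsubs (var ∘ r) ts))) ++ map (map₂ r) T ∎
  where
  open ≡-Reasoning
  D = deduplicate _≟_ (vts ts)
  renamed-D : map r D ≡ deduplicate _≟_ (vts (tsubs (var ∘ r) ts))
  renamed-D =
    trans (map-deduplicate r-injective (vts ts)) (cong (deduplicate _≟_) (sym (vts-rename r ts)))

s≤s-⊔ : ∀ {a b m n} → a ≤ m → b ≤ n → suc (a ⊔ b) ≤ suc (m ⊔ n)
s≤s-⊔ a≤m b≤n = s≤s (⊔-mono-≤ a≤m b≤n)

rename : ∀ {C s} (π : Proof C s) {r} → Injective _≡_ _≡_ r →
  ∀ {Γ′ Δ′} → Γ′ ≋[ r ] Seq.Γs s → Δ′ ≋[ r ] Seq.Δs s →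
  Proof≤ C ⟨ Seq.Rs s ∣ map (map₂ r) (Seq.Ts s) ∣ Γ′ ⊢ Δ′ ⟩ (height π)
rename (perm (eR , eT , eΓ , eΔ) π) inj Γ≋ Δ≋ with Pointwise-↭ eΓ Γ≋ | Pointwise-↭ eΔ Δ≋
... | _ , eΓ′ , Γ≋′ | _ , eΔ′ , Δ≋′ =
  Σ.map (perm (eR , ↭.map⁺ (map₂ _) eT , eΓ′ , eΔ′)) id (rename π inj Γ≋′ Δ≋′)
rename (ax {R} {T} i w↠u) inj {(_ , χ) ∷ _} {(_ , χ′) ∷ _} Γ≋@((refl , e) ∷ _) Δ≋@((refl , e′) ∷ _)
  with ≈-atom⁻ χ e | ≈-atom⁻ χ′ e′
... | refl | refl = ax (IsSequent-rename R T Γ≋ Δ≋ i) w↠u , z≤n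
rename (⊥L {R} {T} i) inj {(_ , χ) ∷ _} Γ≋@((refl , e) ∷ _) Δ≋ with db-⊥⁻ χ e
... | refl = ⊥L (IsSequent-rename R T Γ≋ Δ≋ i) , z≤n
rename (⊤R {R} {T} i) inj {Δ′ = (_ , χ) ∷ _} Γ≋ Δ≋@((refl , e) ∷ _) with db-⊤⁻ χ e
... | refl = ⊤R (IsSequent-rename R T Γ≋ Δ≋ i) , z≤n
rename (∧L {R} {T} i π) inj {(_ , χ) ∷ _} Γ≋@((refl , e) ∷ Γ≋₀) Δ≋ with db-bin⁻ χ e
... | _ , _ , refl , e₁ , e₂ =
  Σ.map (∧L (IsSequent-rename R T Γ≋ Δ≋ i)) s≤s (rename π inj ((refl , e₁) ∷ (refl , e₂) ∷ Γ≋₀) Δ≋)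
rename (∧R {R} {T} i π ρ) inj {Δ′ = (_ , χ) ∷ _} Γ≋ Δ≋@((refl , e) ∷ Δ≋₀) with db-bin⁻ χ e
... | _ , _ , refl , e₁ , e₂ =
  Σ.zip (∧R (IsSequent-rename R T Γ≋ Δ≋ i)) s≤s-⊔
    (rename π inj Γ≋ ((refl , e₁) ∷ Δ≋₀)) (rename ρ inj Γ≋ ((refl , e₂) ∷ Δ≋₀))
rename (∨L {R} {T} i π ρ) inj {(_ , χ) ∷ _} Γ≋@((refl , e) ∷ Γ≋₀) Δ≋ with db-bin⁻ χ e
... | _ , _ , refl , e₁ , e₂ =
  Σ.zip (∨L (IsSequent-rename R T Γ≋ Δ≋ i)) s≤s-⊔
    (rename π inj ((refl , e₁) ∷ Γ≋₀) Δ≋) (rename ρ inj ((refl , e₂) ∷ Γ≋₀) Δ≋)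
rename (∨R {R} {T} i π) inj {Δ′ = (_ , χ) ∷ _} Γ≋ Δ≋@((refl , e) ∷ Δ≋₀) with db-bin⁻ χ e
... | _ , _ , refl , e₁ , e₂ =
  Σ.map (∨R (IsSequent-rename R T Γ≋ Δ≋ i)) s≤s (rename π inj Γ≋ ((refl , e₁) ∷ (refl , e₂) ∷ Δ≋₀))
rename (⇒L {R} {T} i w↠u π ρ) inj {(_ , χ) ∷ _} Γ≋@((refl , e) ∷ Γ≋₀) Δ≋ with db-bin⁻ χ e
... | _ , _ , refl , e₁ , e₂ =
  Σ.zip (⇒L (IsSequent-rename R T Γ≋ Δ≋ i) w↠u) s≤s-⊔
    (rename π inj Γ≋ ((refl , e₁) ∷ Δ≋)) (rename ρ inj ((refl , e) ∷ (refl , e₂) ∷ Γ≋₀) Δ≋)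
rename (⇒R {R} {T} i u∉ π) inj {Δ′ = (_ , χ) ∷ _} Γ≋ Δ≋@((refl , e) ∷ Δ≋₀) with db-bin⁻ χ e
... | _ , _ , refl , e₁ , e₂ =
  Σ.map (⇒R (IsSequent-rename R T Γ≋ Δ≋ i) (FreshL-rename R T Γ≋ Δ≋ u∉)) s≤s
    (rename π inj ((refl , e₁) ∷ Γ≋) ((refl , e₂) ∷ Δ≋₀))
rename (-<L {R} {T} i u∉ π) inj {(_ , χ) ∷ _} Γ≋@((refl , e) ∷ Γ≋₀) Δ≋ with db-bin⁻ χ e
... | _ , _ , refl , e₁ , e₂ =
  Σ.map (-<L (IsSequent-rename R T Γ≋ Δ≋ i) (FreshL-rename R T Γ≋ Δ≋ u∉)) s≤s
    (rename π inj ((refl , e₁) ∷ Γ≋₀) ((refl , e₂) ∷ Δ≋))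
rename (-<R {R} {T} i w↠u π ρ) inj {Δ′ = (_ , χ) ∷ _} Γ≋ Δ≋@((refl , e) ∷ Δ≋₀) with db-bin⁻ χ e
... | _ , _ , refl , e₁ , e₂ =
  Σ.zip (-<R (IsSequent-rename R T Γ≋ Δ≋ i) w↠u) s≤s-⊔
    (rename π inj Γ≋ ((refl , e) ∷ (refl , e₁) ∷ Δ≋₀)) (rename ρ inj ((refl , e₂) ∷ Γ≋) Δ≋)
rename (∃L {R} {T} i y∉ π) inj {(_ , χ) ∷ _} Γ≋@((refl , e) ∷ Γ≋₀) Δ≋ with db-quant⁻ χ e
... | _ , _ , refl =
  Σ.map (∃L (IsSequent-rename R T Γ≋ Δ≋ i) (FreshV-rename R T Γ≋ Δ≋ inj y∉)) s≤s
    (rename π inj ((refl , instance-≈ ∃q e refl) ∷ Γ≋₀) Δ≋)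
rename {C} (∃R {R} {T} t i av π) {r} inj {Δ′ = (_ , χ) ∷ _} Γ≋ Δ≋@((refl , e) ∷ Δ≋₀)
  with db-quant⁻ χ e
... | _ , _ , refl =
  Σ.map (∃R (tsub (var ∘ r) t) (IsSequent-rename R T Γ≋ Δ≋ i) (Avail-rename C t av)) s≤s
    (rename π inj Γ≋ ((refl , e) ∷ (refl , instance-≈ ∃q e (dbT-tsub free (var ∘ r) t)) ∷ Δ≋₀))
rename {C} (∀L {R} {T} t i w↠u av π) {r} inj {(_ , χ) ∷ _} Γ≋@((refl , e) ∷ Γ≋₀) Δ≋
  with db-quant⁻ χ e
... | _ , _ , refl =
  Σ.map (∀L (tsub (var ∘ r) t) (IsSequent-rename R T Γ≋ Δ≋ i) w↠u (Avail-rename C t av)) s≤s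
    (rename π inj ((refl , e) ∷ (refl , instance-≈ ∀q e (dbT-tsub free (var ∘ r) t)) ∷ Γ≋₀) Δ≋)
rename (∀R {R} {T} i u∉ y∉ π) inj {Δ′ = (_ , χ) ∷ _} Γ≋ Δ≋@((refl , e) ∷ Δ≋₀) with db-quant⁻ χ e
... | _ , _ , refl =
  Σ.map (∀R (IsSequent-rename R T Γ≋ Δ≋ i) (FreshL-rename R T Γ≋ Δ≋ u∉)
             (FreshV-rename R T Γ≋ Δ≋ inj y∉))
    s≤s (rename π inj Γ≋ ((refl , instance-≈ ∀q e refl) ∷ Δ≋₀))
rename (ds {R} {T} {w = w} {ts = ts} c i π) inj {(_ , χ) ∷ _} Γ≋@((refl , e) ∷ _) Δ≋
  with ≈-atom⁻ χ e
... | refl =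
  Σ.map (ds c (IsSequent-rename R T Γ≋ Δ≋ i) ∘
         perm (↭-refl , ↭-reflexive (ds-rename inj w ts T) , ↭-refl , ↭-refl))
    s≤s (rename π inj Γ≋ Δ≋)

≋-refl : ∀ {r} Γ → (∀ {v} → v ∈ concatMap (fv ∘ proj₂) Γ → r v ≡ v) → Γ ≋[ r ] Γ
≋-refl [] _ = []
≋-refl ((_ , φ) ∷ Γ) fixes = (refl , ≈-refl φ (fixes ∘ ∈-++⁺ˡ)) ∷ ≋-refl Γ (fixes ∘ ∈-++⁺ʳ (fv φ))

vars-fixed : ∀ {r} s → (∀ {v} → v ∈ vars s → r v ≡ v) →
  map (map₂ r) (Seq.Ts s) ≡ Seq.Ts s × Seq.Γs s ≋[ r ] Seq.Γs s × Seq.Δs s ≋[ r ] Seq.Δs s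
vars-fixed ⟨ R ∣ T ∣ Γ ⊢ Δ ⟩ fixes =
  map-id-local (All.tabulate λ {(l , v)} lv∈T → cong (l ,_) (fixes (∈-++⁺ˡ (∈-map⁺ proj₂ lv∈T)))) ,
  ≋-refl Γ (fixes ∘ ∈-++⁺ʳ (map proj₂ T) ∘ in-concatMap ∘ ∈-++⁺ˡ) ,
  ≋-refl Δ (fixes ∘ ∈-++⁺ʳ (map proj₂ T) ∘ in-concatMap ∘ ∈-++⁺ʳ (concatMap (fv ∘ proj₂) Γ))
  where
  in-concatMap : ∀ {v} → v ∈ concatMap (fv ∘ proj₂) Γ ++ concatMap (fv ∘ proj₂) Δ →
    v ∈ concatMap (fv ∘ proj₂) (Γ ++ Δ)
  in-concatMap = ≡-subst (_ ∈_) (sym (concatMap-++ (fv ∘ proj₂) Γ Δ))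

rename-eigenvariable : ∀ {C R T Γ Δ Γ′ Δ′ l y y′ r} (π : Proof C ⟨ R ∣ (l , y) ∷ T ∣ Γ ⊢ Δ ⟩) →
  Injective _≡_ _≡_ r → r y ≡ y′ → map (map₂ r) T ≡ T → Γ′ ≋[ r ] Γ → Δ′ ≋[ r ] Δ →
  Proof≤ C ⟨ R ∣ (l , y′) ∷ T ∣ Γ′ ⊢ Δ′ ⟩ (height π)
rename-eigenvariable {C} {R} {Γ′ = Γ′} {Δ′} {l} π inj refl T-fixed Γ≋ Δ≋ =
  ≡-subst (λ T′ → Proof≤ C ⟨ R ∣ (l , _) ∷ T′ ∣ Γ′ ⊢ Δ′ ⟩ (height π)) T-fixed (rename π inj Γ≋ Δ≋)

-- Weakening by a domain atom

addDom : DomAtom → Seq → Seq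
addDom d ⟨ R ∣ T ∣ Γ ⊢ Δ ⟩ = ⟨ R ∣ d ∷ T ∣ Γ ⊢ Δ ⟩

-- A record rather than w ∈ labels s, so that s can be inferred from it.
record _∈ₗ_ (w : Label) (s : Seq) : Set where
  constructor labelled
  field ∈-labels : w ∈ labels s

∈-labsR : ∀ {e R T Γ Δ w} → IsSequent ⟨ e ∷ R ∣ T ∣ Γ ⊢ Δ ⟩ → w ∈ₗ ⟨ e ∷ R ∣ T ∣ Γ ⊢ Δ ⟩ →
  w ∈ labsR (e ∷ R)
∈-labsR {e} {R} (inR , _) (labelled w∈) =
  [ id , All.lookup (inR (λ ())) ]′ (∈-++⁻ (labsR (e ∷ R)) w∈)

IsSequent-weaken : ∀ {s w} x → IsSequent s → w ∈ₗ s → IsSequent (addDom (w , x) s)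
IsSequent-weaken {⟨ [] ∣ _ ∣ _ ⊢ _ ⟩} x (_ , sole , rest) (labelled w∈) =
  (λ []≢[] → ⊥-elim ([]≢[] refl)) ,
  (λ _ → let (w₀ , w₀∈ , all≡w₀) = sole refl in w₀ , there w₀∈ , All.lookup all≡w₀ w∈ ∷ all≡w₀) ,
  rest
IsSequent-weaken {⟨ _ ∷ _ ∣ _ ∣ _ ⊢ _ ⟩} x i@(inR , _ , rest) w∈ =
  (λ _ → ∈-labsR i w∈ ∷ inR (λ ())) , (λ ()) , rest

-- Without relational atoms a sequent has a single label.
label-cases : ∀ {s w l} → IsSequent s → w ∈ₗ s → l ∈ labsTΓΔ s → w ∈ labsR (Seq.Rs s) ⊎ w ≡ l
label-cases {⟨ [] ∣ _ ∣ _ ⊢ _ ⟩} (_ , sole , _) (labelled w∈) l∈ =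
  let (_ , _ , all≡w₀) = sole refl
  in  inj₂ (trans (All.lookup all≡w₀ w∈) (sym (All.lookup all≡w₀ l∈)))
label-cases {⟨ _ ∷ _ ∣ _ ∣ _ ⊢ _ ⟩} i w∈ _ = inj₁ (∈-labsR i w∈)

label-premise : ∀ {R T Γ Δ T′ Γ′ Δ′ w l} →
  IsSequent ⟨ R ∣ T ∣ Γ ⊢ Δ ⟩ → w ∈ₗ ⟨ R ∣ T ∣ Γ ⊢ Δ ⟩ →
  l ∈ labsTΓΔ ⟨ R ∣ T ∣ Γ ⊢ Δ ⟩ → l ∈ labsTΓΔ ⟨ R ∣ T′ ∣ Γ′ ⊢ Δ′ ⟩ → w ∈ₗ ⟨ R ∣ T′ ∣ Γ′ ⊢ Δ′ ⟩
label-premise {R} i w∈ l∈ l∈′ with label-cases i w∈ l∈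
... | inj₁ w∈R = labelled (∈-++⁺ˡ w∈R)
... | inj₂ refl = labelled (∈-++⁺ʳ (labsR R) l∈′)

label-premise-edge : ∀ {R T Γ Δ e T′ Γ′ Δ′ w l} →
  IsSequent ⟨ R ∣ T ∣ Γ ⊢ Δ ⟩ → w ∈ₗ ⟨ R ∣ T ∣ Γ ⊢ Δ ⟩ →
  l ∈ labsTΓΔ ⟨ R ∣ T ∣ Γ ⊢ Δ ⟩ → l ∈ labsR (e ∷ R) → w ∈ₗ ⟨ e ∷ R ∣ T′ ∣ Γ′ ⊢ Δ′ ⟩
label-premise-edge i w∈ l∈ l∈eR with label-cases i w∈ l∈
... | inj₁ w∈R = labelled (∈-++⁺ˡ (there (there w∈R)))
... | inj₂ refl = labelled (∈-++⁺ˡ l∈eR)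

Γ-principal : ∀ {l} (T : List DomAtom) (Γ Δ : List LFormula) →
  l ∈ map proj₁ T ++ l ∷ map proj₁ Γ ++ map proj₁ Δ
Γ-principal T Γ Δ = ∈-++⁺ʳ (map proj₁ T) (here refl)

Δ-principal : ∀ {l} (T : List DomAtom) (Γ Δ : List LFormula) →
  l ∈ map proj₁ T ++ map proj₁ Γ ++ l ∷ map proj₁ Δ
Δ-principal T Γ Δ = ∈-++⁺ʳ (map proj₁ T) (∈-++⁺ʳ (map proj₁ Γ) (here refl))

FreshL-weaken : ∀ {s w u} x → FreshL u s → w ∈ₗ s → FreshL u (addDom (w , x) s)
FreshL-weaken {⟨ R ∣ _ ∣ _ ⊢ _ ⟩} x u∉ (labelled w∈) u∈ with ∈-++⁻ (labsR R) u∈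
... | inj₁ u∈R = u∉ (∈-++⁺ˡ u∈R)
... | inj₂ (here refl) = u∉ w∈
... | inj₂ (there u∈L) = u∉ (∈-++⁺ʳ (labsR R) u∈L)

Avail-weaken : ∀ C {R T u t} d → Avail C R T u t → Avail C R (d ∷ T) u t
Avail-weaken ID d av = All.map (λ (v , v∈T , v↠u) → v , there v∈T , v↠u) av
Avail-weaken CD d _ = tt

labels-↭ : ∀ {s s′} → s ≈S s′ → labels s ↭ labels s′
labels-↭ {⟨ _ ∣ _ ∣ _ ⊢ _ ⟩} {⟨ _ ∣ _ ∣ _ ⊢ _ ⟩} (eR , eT , eΓ , eΔ) =
  ↭.++⁺ (concatMap-↭ _ eR) (↭.++⁺ (↭.map⁺ proj₁ eT) (↭.++⁺ (↭.map⁺ proj₁ eΓ) (↭.map⁺ proj₁ eΔ)))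

transpose : Var → Var → Var → Var
transpose a b v with v ≟ a | v ≟ b
... | yes _ | _ = b
... | no _ | yes _ = a
... | no _ | no _ = v

transpose-a : ∀ a b → transpose a b a ≡ b
transpose-a a b with a ≟ a
... | yes _ = refl
... | no a≢a = ⊥-elim (a≢a refl)

transpose-b : ∀ a b → transpose a b b ≡ a
transpose-b a b with b ≟ a | b ≟ b
... | yes b≡a | _ = b≡a
... | no _ | yes _ = refl
... | no _ | no b≢b = ⊥-elim (b≢b refl)

transpose-fixes : ∀ {a b v} → v ≢ a → v ≢ b → transpose a b v ≡ v
transpose-fixes {a} {b} {v} v≢a v≢b with v ≟ a | v ≟ b
... | yes v≡a | _ = ⊥-elim (v≢a v≡a)
... | no _ | yes v≡b = ⊥-elim (v≢b v≡b)
... | no _ | no _ = refl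

transpose-involutive : ∀ a b v → transpose a b (transpose a b v) ≡ v
transpose-involutive a b v with v ≟ a | v ≟ b
... | yes refl | _ = transpose-b v b
... | no _ | yes refl = transpose-a a v
... | no v≢a | no v≢b = transpose-fixes v≢a v≢b

transpose-injective : ∀ a b → Injective _≡_ _≡_ (transpose a b)
transpose-injective a b {u} {v} tu≡tv = begin
  u                                   ≡⟨ sym (transpose-involutive a b u) ⟩
  transpose a b (transpose a b u)     ≡⟨ cong (transpose a b) tu≡tv ⟩
  transpose a b (transpose a b v)     ≡⟨ transpose-involutive a b v ⟩
  v                                   ∎
  where open ≡-Reasoning

fresh-transposition : ∀ {y} V x → y ∉ V →
  ∃[ y′ ] y′ ∉ x ∷ V × (∀ {v} → v ∈ V → transpose y y′ v ≡ v)
fresh-transposition V x y∉V =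
  y′ , y′∉ , λ v∈V → transpose-fixes (λ { refl → y∉V v∈V }) (λ { refl → y′∉ (there v∈V) })
  where
  y′ = suc (maxList (x ∷ V))
  y′∉ = suc-maxList-∉ (x ∷ V)

-- Induction on a height bound, since the eigenvariable cases recurse on a renamed premise.
Weakening : ℕ → Set
Weakening n = ∀ {C s} (π : Proof C s) → height π ≤ n →
  ∀ {w} x → w ∈ₗ s → Proof≤ C (addDom (w , x) s) (height π)

weaken-∃L : ∀ {n C R T Γ Δ w₀ x₀ y φ} → Weakening n →
  IsSequent ⟨ R ∣ T ∣ (w₀ , ex x₀ φ) ∷ Γ ⊢ Δ ⟩ → FreshV y ⟨ R ∣ T ∣ (w₀ , ex x₀ φ) ∷ Γ ⊢ Δ ⟩ →
  (π : Proof C ⟨ R ∣ (w₀ , y) ∷ T ∣ (w₀ , φ [ var y / x₀ ]) ∷ Γ ⊢ Δ ⟩) → height π ≤ n →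
  ∀ {w} x → w ∈ₗ ⟨ R ∣ T ∣ (w₀ , ex x₀ φ) ∷ Γ ⊢ Δ ⟩ →
  Proof≤ C ⟨ R ∣ (w , x) ∷ T ∣ (w₀ , ex x₀ φ) ∷ Γ ⊢ Δ ⟩ (suc (height π))
weaken-∃L {R = R} {T} {Γ} {Δ} {w₀} {x₀} {y} {φ} weaken i y∉ π π≤n x w∈
  with fresh-transposition (vars ⟨ R ∣ T ∣ (w₀ , ex x₀ φ) ∷ Γ ⊢ Δ ⟩) x y∉
... | y′ , y′∉ , fixes with vars-fixed ⟨ R ∣ T ∣ (w₀ , ex x₀ φ) ∷ Γ ⊢ Δ ⟩ fixes
... | T-fixed , (_ , ∃φ≈∃φ) ∷ Γ≋ , Δ≋
  with rename-eigenvariable π (transpose-injective y y′) (transpose-a y y′) T-fixed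
         ((refl , instance-≈ ∃q ∃φ≈∃φ (cong free (sym (transpose-a y y′)))) ∷ Γ≋) Δ≋
... | π′ , π′≤π
  with weaken π′ (≤-trans π′≤π π≤n) x (label-premise i w∈ (Γ-principal T Γ Δ) (here refl))
... | π″ , π″≤π′ =
  ∃L (IsSequent-weaken x i w∈) y′∉ (perm (↭-refl , ↭.swap _ _ ↭-refl , ↭-refl , ↭-refl) π″) ,
  s≤s (≤-trans π″≤π′ π′≤π)

weaken-∀R : ∀ {n C R T Γ Δ w₀ u x₀ y φ} → Weakening n →
  IsSequent ⟨ R ∣ T ∣ Γ ⊢ (w₀ , all x₀ φ) ∷ Δ ⟩ →
  FreshL u ⟨ R ∣ T ∣ Γ ⊢ (w₀ , all x₀ φ) ∷ Δ ⟩ → FreshV y ⟨ R ∣ T ∣ Γ ⊢ (w₀ , all x₀ φ) ∷ Δ ⟩ →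
  (π : Proof C ⟨ (w₀ , u) ∷ R ∣ (u , y) ∷ T ∣ Γ ⊢ (u , φ [ var y / x₀ ]) ∷ Δ ⟩) → height π ≤ n →
  ∀ {w} x → w ∈ₗ ⟨ R ∣ T ∣ Γ ⊢ (w₀ , all x₀ φ) ∷ Δ ⟩ →
  Proof≤ C ⟨ R ∣ (w , x) ∷ T ∣ Γ ⊢ (w₀ , all x₀ φ) ∷ Δ ⟩ (suc (height π))
weaken-∀R {R = R} {T} {Γ} {Δ} {w₀} {u} {x₀} {y} {φ} weaken i u∉ y∉ π π≤n x w∈
  with fresh-transposition (vars ⟨ R ∣ T ∣ Γ ⊢ (w₀ , all x₀ φ) ∷ Δ ⟩) x y∉
... | y′ , y′∉ , fixes with vars-fixed ⟨ R ∣ T ∣ Γ ⊢ (w₀ , all x₀ φ) ∷ Δ ⟩ fixes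
... | T-fixed , Γ≋ , (_ , ∀φ≈∀φ) ∷ Δ≋
  with rename-eigenvariable π (transpose-injective y y′) (transpose-a y y′) T-fixed
         Γ≋ ((refl , instance-≈ ∀q ∀φ≈∀φ (cong free (sym (transpose-a y y′)))) ∷ Δ≋)
... | π′ , π′≤π
  with weaken π′ (≤-trans π′≤π π≤n) x (label-premise-edge i w∈ (Δ-principal T Γ Δ) (here refl))
... | π″ , π″≤π′ =
  ∀R (IsSequent-weaken x i w∈) (FreshL-weaken x u∉ w∈) y′∉
    (perm (↭-refl , ↭.swap _ _ ↭-refl , ↭-refl , ↭-refl) π″) ,
  s≤s (≤-trans π″≤π′ π′≤π)

weaken : ∀ n → Weakening n
weaken n (perm eq@(eR , eT , eΓ , eΔ) π) π≤n x (labelled w∈) =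
  Σ.map (perm (eR , ↭.prep _ eT , eΓ , eΔ)) id
    (weaken n π π≤n x (labelled (↭.∈-resp-↭ (↭-sym (labels-↭ eq)) w∈)))
weaken n (ax i w↠u) _ x w∈ = ax (IsSequent-weaken x i w∈) w↠u , z≤n
weaken n (⊥L i) _ x w∈ = ⊥L (IsSequent-weaken x i w∈) , z≤n
weaken n (⊤R i) _ x w∈ = ⊤R (IsSequent-weaken x i w∈) , z≤n
weaken (suc n) (∧L {T = T} {Γ} {Δ} {w₀} {φ} {ψ} i π) (s≤s π≤n) x w∈ =
  Σ.map (∧L (IsSequent-weaken x i w∈)) s≤s
    (weaken n π π≤n x (label-premise i w∈ (Γ-principal T Γ Δ) (Γ-principal T ((w₀ , ψ) ∷ Γ) Δ)))
weaken (suc n) (∧R {T = T} {Γ} {Δ} i π ρ) (s≤s πρ≤n) x w∈ =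
  Σ.zip (∧R (IsSequent-weaken x i w∈)) s≤s-⊔
    (weaken n π (m⊔n≤o⇒m≤o _ _ πρ≤n) x (label-premise i w∈ (Δ-principal T Γ Δ) (Δ-principal T Γ Δ)))
    (weaken n ρ (m⊔n≤o⇒n≤o _ _ πρ≤n) x (label-premise i w∈ (Δ-principal T Γ Δ) (Δ-principal T Γ Δ)))
weaken (suc n) (∨L {T = T} {Γ} {Δ} i π ρ) (s≤s πρ≤n) x w∈ =
  Σ.zip (∨L (IsSequent-weaken x i w∈)) s≤s-⊔
    (weaken n π (m⊔n≤o⇒m≤o _ _ πρ≤n) x (label-premise i w∈ (Γ-principal T Γ Δ) (Γ-principal T Γ Δ)))
    (weaken n ρ (m⊔n≤o⇒n≤o _ _ πρ≤n) x (label-premise i w∈ (Γ-principal T Γ Δ) (Γ-principal T Γ Δ)))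
weaken (suc n) (∨R {T = T} {Γ} {Δ} {w₀} {φ} {ψ} i π) (s≤s π≤n) x w∈ =
  Σ.map (∨R (IsSequent-weaken x i w∈)) s≤s
    (weaken n π π≤n x (label-premise i w∈ (Δ-principal T Γ Δ) (Δ-principal T Γ ((w₀ , ψ) ∷ Δ))))
weaken (suc n) (⇒L {T = T} {Γ} {Δ} {w₀} {u} {φ} {ψ} i w↠u π ρ) (s≤s πρ≤n) x w∈ =
  Σ.zip (⇒L (IsSequent-weaken x i w∈) w↠u) s≤s-⊔
    (weaken n π (m⊔n≤o⇒m≤o _ _ πρ≤n) x
      (label-premise i w∈ (Γ-principal T Γ Δ) (Γ-principal T Γ ((u , φ) ∷ Δ))))
    (weaken n ρ (m⊔n≤o⇒n≤o _ _ πρ≤n) x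
      (label-premise i w∈ (Γ-principal T Γ Δ) (Γ-principal T ((u , ψ) ∷ Γ) Δ)))
weaken (suc n) (⇒R {T = T} {Γ} {Δ} i u∉ π) (s≤s π≤n) x w∈ =
  Σ.map (⇒R (IsSequent-weaken x i w∈) (FreshL-weaken x u∉ w∈)) s≤s
    (weaken n π π≤n x (label-premise-edge i w∈ (Δ-principal T Γ Δ) (here refl)))
weaken (suc n) (-<L {T = T} {Γ} {Δ} i u∉ π) (s≤s π≤n) x w∈ =
  Σ.map (-<L (IsSequent-weaken x i w∈) (FreshL-weaken x u∉ w∈)) s≤s
    (weaken n π π≤n x (label-premise-edge i w∈ (Γ-principal T Γ Δ) (there (here refl))))
weaken (suc n) (-<R {T = T} {Γ} {Δ} {w₀} {u} {φ} {ψ} i w↠u π ρ) (s≤s πρ≤n) x w∈ =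
  Σ.zip (-<R (IsSequent-weaken x i w∈) w↠u) s≤s-⊔
    (weaken n π (m⊔n≤o⇒m≤o _ _ πρ≤n) x
      (label-premise i w∈ (Δ-principal T Γ Δ) (Δ-principal T Γ ((w₀ , φ) ∷ Δ))))
    (weaken n ρ (m⊔n≤o⇒n≤o _ _ πρ≤n) x
      (label-premise i w∈ (Δ-principal T Γ Δ) (Δ-principal T ((w₀ , ψ) ∷ Γ) Δ)))
weaken (suc n) (∃L i y∉ π) (s≤s π≤n) x w∈ = weaken-∃L (weaken n) i y∉ π π≤n x w∈
weaken (suc n) {C} (∃R {T = T} {Γ} {Δ} {w₀} {x₀} {φ} t i av π) (s≤s π≤n) x w∈ =
  Σ.map (∃R t (IsSequent-weaken x i w∈) (Avail-weaken C _ av)) s≤s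
    (weaken n π π≤n x
      (label-premise i w∈ (Δ-principal T Γ Δ) (Δ-principal T Γ ((w₀ , φ [ t / x₀ ]) ∷ Δ))))
weaken (suc n) {C} (∀L {T = T} {Γ} {Δ} {w₀} {u} {x₀} {φ} t i w↠u av π) (s≤s π≤n) x w∈ =
  Σ.map (∀L t (IsSequent-weaken x i w∈) w↠u (Avail-weaken C _ av)) s≤s
    (weaken n π π≤n x
      (label-premise i w∈ (Γ-principal T Γ Δ) (Γ-principal T ((u , φ [ t / x₀ ]) ∷ Γ) Δ)))
weaken (suc n) (∀R i u∉ y∉ π) (s≤s π≤n) x w∈ = weaken-∀R (weaken n) i u∉ y∉ π π≤n x w∈
weaken (suc n) (ds {T = T} {Γ} {Δ} {w₀} {p} {ts} c i π) (s≤s π≤n) {w} x w∈ =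
  Σ.map (ds c (IsSequent-weaken x i w∈) ∘ perm (↭-refl , ↭-sym (↭.shift (w , x) D T) , ↭-refl , ↭-refl))
    s≤s
    (weaken n π π≤n x (label-premise i w∈ (Γ-principal T Γ Δ) (Γ-principal (D ++ T) Γ Δ)))
  where D = map (λ z → (w₀ , z)) (deduplicate _≟_ (vts ts))

no-proof-of-empty : ∀ {C R T} → ¬ Proof C ⟨ R ∣ T ∣ [] ⊢ [] ⟩
no-proof-of-empty (perm (_ , _ , eΓ , eΔ) π) with ↭.↭-empty-inv eΓ | ↭.↭-empty-inv eΔ
... | refl | refl = no-proof-of-empty π

proof-label : ∀ {C s} → Proof C s → ∃[ l ] l ∈ labsTΓΔ s
proof-label {s = ⟨ _ ∣ T ∣ (l , _) ∷ Γ ⊢ Δ ⟩} _ = l , Γ-principal T Γ Δ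
proof-label {s = ⟨ _ ∣ T ∣ [] ⊢ (l , _) ∷ Δ ⟩} _ = l , Δ-principal T [] Δ
proof-label {s = ⟨ _ ∣ _ ∣ [] ⊢ [] ⟩} π = ⊥-elim (no-proof-of-empty π)

weakened-label : ∀ {C R T Γ Δ w x} → Proof C ⟨ R ∣ T ∣ Γ ⊢ Δ ⟩ →
  IsSequent ⟨ R ∣ (w , x) ∷ T ∣ Γ ⊢ Δ ⟩ → w ∈ₗ ⟨ R ∣ T ∣ Γ ⊢ Δ ⟩
weakened-label {R = []} π (_ , sole , _) with sole refl | proof-label π
... | _ , _ , w≡w₀ ∷ all≡w₀ | l , l∈ =
  labelled (≡-subst (_∈ _) (trans (All.lookup all≡w₀ l∈) (sym w≡w₀)) l∈)
weakened-label {R = _ ∷ _} π (inR , _) = labelled (∈-++⁺ˡ (All.head (inR (λ ()))))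

lemma35 : (C : Cond) (R : List RelAtom) (T : List DomAtom) (Γ Δ : List LFormula) (π : Proof C ⟨ R ∣ T ∣ Γ ⊢ Δ ⟩)
    (x : Var) (w : Label) →
    IsSequent ⟨ R ∣ (w , x) ∷ T ∣ Γ ⊢ Δ ⟩ →
    Σ (Proof C ⟨ R ∣ (w , x) ∷ T ∣ Γ ⊢ Δ ⟩) (λ π' → height π' ≤ height π)
lemma35 C R T Γ Δ π x w is = weaken (height π) π ≤-refl x (weakened-label {x = x} π is)
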